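{- Let $t\le k$ be positive integers and $n,s\ge0$ integers. The number of words $w\in[k]^n$ with $\overleftarrow{\mathrm{des}}_{[t]}(w)=s$, which also equals the number of words $w\in[k]^n$ with $\overleftarrow{\mathrm{ris}}_{\{k+1-t,\ldots,k\}}(w)=s$, is $$\sum_{m=0}^n\sum_{a=0}^m\sum_{b=0}^{m-a}(-1)^{n-a-b-s}\binom{m}{a}\binom{m-a}{b}\binom{ta}{n-b}\binom{n-m}{s}(k-t)^b.$$
   Context: $[k]=\{1,\ldots,k\}$, $[k]^n$ is the set of words of length $n$ over $[k]$. For a word $w=w_1\cdots w_n$ and $X\subseteq\mathbb{N}$, $\overleftarrow{\mathrm{des}}_X(w)=|\{i:w_i>w_{i+1},\ w_i\in X\}|$ and $\overleftarrow{\mathrm{ris}}_X(w)=|\{i:w_i<w_{i+1},\ w_i\in X\}|$. Conventions: $\binom{a}{b}=0$ if $b<0$ or $b>a$ (for $a\ge0$), and $0^0=1$. -}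

module Defs where

open import Data.Nat using (ℕ; zero; suc; _+_; _*_; _∸_; _^_; _%_; _<_; _≤_; _<?_; _≤?_; _≟_)
open import Data.Nat.Combinatorics using (_C_)
open import Data.Fin using (Fin; toℕ)
open import Data.Vec using (Vec; []; _∷_)
open import Data.List using (List; []; _∷_; length; filter; concatMap; map)
open import Data.List.Base using (allFin)
open import Data.Integer as ℤ using (ℤ; +_)
open import Relation.Nullary using (Dec; yes; no)
open import Relation.Nullary.Decidable using (⌊_⌋)
open import Data.Bool using (Bool; true; false; _∧_)
open import Relation.Binary.PropositionalEquality using (_≡_)

-- A word of length n over [k]: the letter j ∈ [k] is represented by the
-- element of Fin k with toℕ equal to j - 1.
Word : ℕ → ℕ → Set
Word k n = Vec (Fin k) n

allWords : (k n : ℕ) → List (Word k n)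
allWords k zero    = [] ∷ []
allWords k (suc n) = concatMap (λ a → map (a ∷_) (allWords k n)) (allFin k)

val : ∀ {k} → Fin k → ℕ
val a = suc (toℕ a)

indicator : Bool → ℕ
indicator true  = 1
indicator false = 0

desX : ∀ {k n} → (ℕ → Bool) → Word k n → ℕ
desX X [] = 0
desX X (a ∷ []) = 0
desX X (a ∷ b ∷ w) = indicator (⌊ val b <? val a ⌋ ∧ X (val a)) + desX X (b ∷ w)

risX : ∀ {k n} → (ℕ → Bool) → Word k n → ℕ
risX X [] = 0
risX X (a ∷ []) = 0
risX X (a ∷ b ∷ w) = indicator (⌊ val a <? val b ⌋ ∧ X (val a)) + risX X (b ∷ w)

inInitial : ℕ → ℕ → Bool
inInitial t x = ⌊ 1 ≤? x ⌋ ∧ ⌊ x ≤? t ⌋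

inFinal : ℕ → ℕ → ℕ → Bool
inFinal k t x = ⌊ suc k ∸ t ≤? x ⌋ ∧ ⌊ x ≤? k ⌋

countWords : (k n : ℕ) → (Word k n → ℕ) → ℕ → ℕ
countWords k n stat s = length (filter (λ w → stat w ≟ s) (allWords k n))

Σℤ : ℕ → (ℕ → ℤ) → ℤ
Σℤ zero    f = f 0
Σℤ (suc n) f = Σℤ n f ℤ.+ f (suc n)

-- (-1)^e for an integer exponent e (the exponent n-a-b-s may be negative;
-- (-1)^e depends only on the parity of e)
signℤ : ℤ → ℤ
signℤ e with ℤ.∣ e ∣ % 2
... | zero = + 1
... | _    = ℤ.- (+ 1)

-- Binomial coefficient; Data.Nat.Combinatorics' _C_ is 0 when b > a.
binom : ℕ → ℕ → ℕ
binom a b = a C b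

formula : (k t n s : ℕ) → ℤ
formula k t n s =
  Σℤ n λ m → Σℤ m λ a → Σℤ (m ∸ a) λ b →
    signℤ (+ n ℤ.- + a ℤ.- + b ℤ.- + s)
      ℤ.* (+ (binom m a * binom (m ∸ a) b * binom (t * a) (n ∸ b)
               * binom (n ∸ m) s * (k ∸ t) ^ b))

{-# OPTIONS --safe #-}
module Submission where

-- Encode letters 0-based and give letter j the weight P_j = (1+X)^j if j < t and P_j = 1 otherwise.
-- For j < t the geometric sum gives P_j = 1 + X·Σ_{l<j} P_l, and B = Σ_{j<k} P_j satisfies
-- X·B = (1+X)^t + (k−t)X − 1.  A descent adds 0 or 1 to des, and C(e + d, r) = C(d, r) + e·C(d, r−1)
-- for e ∈ {0,1}; so by induction on the length, Σ_{w ∈ [k]^n} C(des(a w), r) = [X^r] P_a·B^(n−r),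
-- whence the binomial moments Σ_{w ∈ [k]^n} C(des w, r) are [X^r] B^(n−r) = [X^n] (X·B)^(n−r).
-- Binomial inversion, [d = s] = Σ_r C(d, r)·[X^s] (X−1)^r, turns the moments into the count, and
-- expanding (X·B)^m = ((1+X)^t + ((k−t)X − 1))^m twice by the binomial theorem gives the formula.
-- Complementing letters, a ↦ k+1−a, turns rises from {k+1−t,…,k} into descents from [t].

open import Algebra.Bundles using (CommutativeSemiring)
import Algebra.Structures.Biased as Biased
open import Data.Bool using (Bool; true; false; _∧_)
open import Data.Bool.Properties using (∧-zeroʳ; ∧-identityʳ)
open import Data.Empty using (⊥-elim)
open import Data.Fin as Fin using (Fin; toℕ; opposite)
import Data.Fin.Permutation as Permutation
import Data.Fin.Properties as FinP
open import Data.Integer as ℤ using (ℤ; +_; -1ℤ; _+_; _*_; -_; _-_)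
import Data.Integer.Properties as ℤP
open import Data.Integer.Tactic.RingSolver using (solve-∀)
open import Data.List using (List; []; _∷_; _++_; map; concatMap; length; filter)
open import Data.List.Base using (allFin; tabulate)
open import Data.Nat as ℕ using (ℕ; zero; suc; _∸_; _%_; _≤_; z≤n; s≤s; NonZero)
open import Data.Nat.Combinatorics using (_C_; k>n⇒nCk≡0; nCk+nC[k+1]≡[n+1]C[k+1])
open import Data.Nat.DivMod using ([m+n]%n≡m%n)
import Data.Nat.Properties as ℕP
import Data.Nat.Tactic.RingSolver as ℕ-Solver
open import Data.Product using (_×_; _,_)
open import Data.Sum using (inj₁; inj₂)
open import Data.Vec using ([]; _∷_)
import Data.Vec as Vec
open import Function using (_∘_)
open import Function.Bundles using (_⇔_; mk⇔)
open import Level using (0ℓ)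
open import Relation.Binary.PropositionalEquality
open import Relation.Binary.Structures using (IsEquivalence)
open import Relation.Nullary using (Dec; yes; no; ¬_)
open import Relation.Nullary.Decidable using (⌊_⌋; isYes≗does; dec-true; dec-false; does-⇔)

open import Algebra.Properties.CommutativeMonoid.Sum ℤP.+-0-commutativeMonoid using (∑-permute) renaming (sum to ∑ᶠ)
open import Algebra.Properties.CommutativeSemigroup ℤP.+-commutativeSemigroup using (interchange)

open import Defs

-- Finite sums

-- ∑[ i < n ] sums over i < n, whereas Σℤ n of Defs sums over i ≤ n.
∑ : ℕ → (ℕ → ℤ) → ℤ
∑ zero    f = + 0
∑ (suc n) f = ∑ n f + f n

syntax ∑ n (λ i → e) = ∑[ i < n ] e

∑-cong : ∀ n {f g : ℕ → ℤ} → (∀ i → i ℕ.< n → f i ≡ g i) → ∑ n f ≡ ∑ n g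
∑-cong zero    eq = refl
∑-cong (suc n) eq = cong₂ _+_ (∑-cong n (λ i i<n → eq i (ℕP.m<n⇒m<1+n i<n))) (eq n ℕP.≤-refl)

∑-zero : ∀ n {f : ℕ → ℤ} → (∀ i → i ℕ.< n → f i ≡ + 0) → ∑ n f ≡ + 0
∑-zero zero    eq = refl
∑-zero (suc n) eq = cong₂ _+_ (∑-zero n (λ i i<n → eq i (ℕP.m<n⇒m<1+n i<n))) (eq n ℕP.≤-refl)

∑-const : ∀ n c → ∑[ _ < n ] c ≡ + n * c
∑-const zero    c = refl
∑-const (suc n) c = trans (cong (_+ c) (∑-const n c)) (trans (ℤP.+-comm (+ n * c) c) (sym (ℤP.suc-* (+ n) c)))

∑-distrib-+ : ∀ n (f g : ℕ → ℤ) → ∑[ i < n ] (f i + g i) ≡ ∑ n f + ∑ n g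
∑-distrib-+ zero    f g = refl
∑-distrib-+ (suc n) f g =
  trans (cong (_+ (f n + g n)) (∑-distrib-+ n f g)) (interchange (∑ n f) (∑ n g) (f n) (g n))

*-distribˡ-∑ : ∀ n c (f : ℕ → ℤ) → c * ∑ n f ≡ ∑[ i < n ] (c * f i)
*-distribˡ-∑ zero    c f = ℤP.*-zeroʳ c
*-distribˡ-∑ (suc n) c f =
  trans (ℤP.*-distribˡ-+ c (∑ n f) (f n)) (cong (_+ c * f n) (*-distribˡ-∑ n c f))

*-distribʳ-∑ : ∀ n c (f : ℕ → ℤ) → ∑ n f * c ≡ ∑[ i < n ] (f i * c)
*-distribʳ-∑ n c f =
  trans (ℤP.*-comm (∑ n f) c) (trans (*-distribˡ-∑ n c f) (∑-cong n (λ i _ → ℤP.*-comm c (f i))))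

∑-head : ∀ n (f : ℕ → ℤ) → ∑ (suc n) f ≡ f 0 + ∑[ i < n ] f (suc i)
∑-head zero    f = ℤP.+-comm (+ 0) (f 0)
∑-head (suc n) f = trans (cong (_+ f (suc n)) (∑-head n f)) (ℤP.+-assoc (f 0) _ _)

∑-split : ∀ m n (f : ℕ → ℤ) → ∑ (m ℕ.+ n) f ≡ ∑ m f + ∑[ i < n ] f (m ℕ.+ i)
∑-split m zero    f = trans (cong (λ l → ∑ l f) (ℕP.+-identityʳ m)) (sym (ℤP.+-identityʳ _))
∑-split m (suc n) f = begin
  ∑ (m ℕ.+ suc n) f                                        ≡⟨ cong (λ l → ∑ l f) (ℕP.+-suc m n) ⟩
  ∑ (m ℕ.+ n) f + f (m ℕ.+ n)                              ≡⟨ cong (_+ f (m ℕ.+ n)) (∑-split m n f) ⟩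
  ∑ m f + ∑[ i < n ] f (m ℕ.+ i) + f (m ℕ.+ n)             ≡⟨ ℤP.+-assoc (∑ m f) _ _ ⟩
  ∑ m f + ∑[ i < suc n ] f (m ℕ.+ i)                       ∎
  where open ≡-Reasoning

∑-truncate : ∀ {m n} {f : ℕ → ℤ} → m ℕ.≤ n → (∀ i → m ℕ.≤ i → i ℕ.< n → f i ≡ + 0) → ∑ n f ≡ ∑ m f
∑-truncate {m} {n} {f} m≤n vanish = begin
  ∑ n f                                  ≡⟨ cong (λ l → ∑ l f) (ℕP.m+[n∸m]≡n m≤n) ⟨
  ∑ (m ℕ.+ (n ∸ m)) f                    ≡⟨ ∑-split m (n ∸ m) f ⟩
  ∑ m f + ∑[ i < n ∸ m ] f (m ℕ.+ i)     ≡⟨ cong (λ x → ∑ m f + x) (∑-zero (n ∸ m) tail) ⟩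
  ∑ m f + + 0                            ≡⟨ ℤP.+-identityʳ (∑ m f) ⟩
  ∑ m f                                  ∎
  where
  open ≡-Reasoning
  tail : ∀ i → i ℕ.< n ∸ m → f (m ℕ.+ i) ≡ + 0
  tail i i<n∸m = vanish (m ℕ.+ i) (ℕP.m≤m+n m i)
    (subst (m ℕ.+ i ℕ.<_) (ℕP.m+[n∸m]≡n m≤n) (ℕP.+-monoʳ-< m i<n∸m))

∑-reverse : ∀ n (f : ℕ → ℤ) → ∑ n f ≡ ∑[ i < n ] f (n ∸ suc i)
∑-reverse zero    f = refl
∑-reverse (suc n) f = begin
  ∑ n f + f n                              ≡⟨ cong (_+ f n) (∑-reverse n f) ⟩
  ∑[ i < n ] f (n ∸ suc i) + f n           ≡⟨ ℤP.+-comm _ (f n) ⟩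
  f n + ∑[ i < n ] f (n ∸ suc i)           ≡⟨ ∑-head n (λ i → f (suc n ∸ suc i)) ⟨
  ∑[ i < suc n ] f (suc n ∸ suc i)         ∎
  where open ≡-Reasoning

∑-triangle : ∀ n (F : ℕ → ℕ → ℤ) →
             ∑[ i < n ] ∑[ j < suc i ] F i j ≡ ∑[ j < n ] ∑[ l < n ∸ j ] F (j ℕ.+ l) j
∑-triangle zero    F = refl
∑-triangle (suc n) F = sym (begin
  ∑[ j < suc n ] ∑[ l < suc n ∸ j ] F (j ℕ.+ l) j   ≡⟨ ∑-cong (suc n) (λ j j<1+n → peel j (ℕP.≤-pred j<1+n)) ⟩
  ∑[ j < suc n ] (A j + F n j)                       ≡⟨ ∑-distrib-+ (suc n) A (F n) ⟩
  ∑ n A + A n + ∑[ j < suc n ] F n j                 ≡⟨ cong (λ x → ∑ n A + x + ∑[ j < suc n ] F n j) A[n]≡0 ⟩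
  ∑ n A + + 0 + ∑[ j < suc n ] F n j                 ≡⟨ cong (_+ ∑[ j < suc n ] F n j) (ℤP.+-identityʳ (∑ n A)) ⟩
  ∑ n A + ∑[ j < suc n ] F n j                       ≡⟨ cong (_+ ∑[ j < suc n ] F n j) (∑-triangle n F) ⟨
  ∑[ i < suc n ] ∑[ j < suc i ] F i j                ∎)
  where
  open ≡-Reasoning
  A : ℕ → ℤ
  A j = ∑[ l < n ∸ j ] F (j ℕ.+ l) j
  A[n]≡0 : A n ≡ + 0
  A[n]≡0 = cong (λ l → ∑[ i < l ] F (n ℕ.+ i) n) (ℕP.n∸n≡0 n)
  peel : ∀ j → j ℕ.≤ n → ∑[ l < suc n ∸ j ] F (j ℕ.+ l) j ≡ A j + F n j
  peel j j≤n = begin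
    ∑[ l < suc n ∸ j ] F (j ℕ.+ l) j        ≡⟨ cong (λ l → ∑[ i < l ] F (j ℕ.+ i) j) (ℕP.+-∸-assoc 1 j≤n) ⟩
    A j + F (j ℕ.+ (n ∸ j)) j               ≡⟨ cong (λ i → A j + F i j) (ℕP.m+[n∸m]≡n j≤n) ⟩
    A j + F n j                             ∎

δ : ℕ → ℕ → ℤ
δ i j = + indicator (i ℕ.≡ᵇ j)

δ-refl : ∀ i → δ i i ≡ + 1
δ-refl zero    = refl
δ-refl (suc i) = δ-refl i

δ-≢ : ∀ {i j} → i ≢ j → δ i j ≡ + 0
δ-≢ {zero}  {zero}  i≢j = ⊥-elim (i≢j refl)
δ-≢ {zero}  {suc j} _   = refl
δ-≢ {suc i} {zero}  _   = refl
δ-≢ {suc i} {suc j} i≢j = δ-≢ (i≢j ∘ cong suc)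

∑-δ : ∀ n (f : ℕ → ℤ) s → (n ℕ.≤ s → f s ≡ + 0) → ∑[ j < n ] (f j * δ j s) ≡ f s
∑-δ zero    f s outside = sym (outside z≤n)
∑-δ (suc n) f s outside with n ℕ.≟ s
... | yes refl = begin
  ∑[ j < n ] (f j * δ j n) + f n * δ n n   ≡⟨ cong₂ _+_ (∑-zero n below) (cong (f n *_) (δ-refl n)) ⟩
  + 0 + f n * + 1                          ≡⟨ ℤP.+-identityˡ _ ⟩
  f n * + 1                                ≡⟨ ℤP.*-identityʳ (f n) ⟩
  f n                                      ∎
  where
  open ≡-Reasoning
  below : ∀ j → j ℕ.< n → f j * δ j n ≡ + 0
  below j j<n = trans (cong (f j *_) (δ-≢ (ℕP.<⇒≢ j<n))) (ℤP.*-zeroʳ (f j))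
... | no n≢s = begin
  ∑[ j < n ] (f j * δ j s) + f n * δ n s   ≡⟨ cong₂ _+_ (∑-δ n f s (outside ∘ (λ n≤s → ℕP.≤∧≢⇒< n≤s n≢s))) (cong (f n *_) (δ-≢ n≢s)) ⟩
  f s + f n * + 0                          ≡⟨ cong (λ x → f s + x) (ℤP.*-zeroʳ (f n)) ⟩
  f s + + 0                                ≡⟨ ℤP.+-identityʳ (f s) ⟩
  f s                                      ∎
  where open ≡-Reasoning

-- Formal power series

Series : Set
Series = ℕ → ℤ

infixl 6 _⊕_
infixl 7 _⊛_

_⊕_ : Series → Series → Series
(f ⊕ g) n = f n + g n

_⊛_ : Series → Series → Series
(f ⊛ g) n = ∑[ i < suc n ] (f i * g (n ∸ i))

𝟘 𝟙 : Series
𝟘 _       = + 0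
𝟙 zero    = + 1
𝟙 (suc _) = + 0

⊛-cong : ∀ {f f′ g g′} → f ≗ f′ → g ≗ g′ → f ⊛ g ≗ f′ ⊛ g′
⊛-cong f≗f′ g≗g′ n = ∑-cong (suc n) (λ i _ → cong₂ _*_ (f≗f′ i) (g≗g′ (n ∸ i)))

⊛-assoc : ∀ f g h → (f ⊛ g) ⊛ h ≗ f ⊛ (g ⊛ h)
⊛-assoc f g h n = begin
  ∑[ i < suc n ] (∑[ j < suc i ] (f j * g (i ∸ j)) * h (n ∸ i))
    ≡⟨ ∑-cong (suc n) (λ i _ → *-distribʳ-∑ (suc i) (h (n ∸ i)) _) ⟩
  ∑[ i < suc n ] ∑[ j < suc i ] (f j * g (i ∸ j) * h (n ∸ i))
    ≡⟨ ∑-triangle (suc n) _ ⟩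
  ∑[ j < suc n ] ∑[ l < suc n ∸ j ] (f j * g (j ℕ.+ l ∸ j) * h (n ∸ (j ℕ.+ l)))
    ≡⟨ ∑-cong (suc n) (λ j j<1+n → inner j (ℕP.≤-pred j<1+n)) ⟩
  ∑[ j < suc n ] (f j * ∑[ l < suc (n ∸ j) ] (g l * h (n ∸ j ∸ l)))
    ∎
  where
  open ≡-Reasoning
  inner : ∀ j → j ℕ.≤ n →
          ∑[ l < suc n ∸ j ] (f j * g (j ℕ.+ l ∸ j) * h (n ∸ (j ℕ.+ l))) ≡
          f j * ∑[ l < suc (n ∸ j) ] (g l * h (n ∸ j ∸ l))
  inner j j≤n = begin
    ∑[ l < suc n ∸ j ] (f j * g (j ℕ.+ l ∸ j) * h (n ∸ (j ℕ.+ l)))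
      ≡⟨ cong (λ m → ∑[ l < m ] (f j * g (j ℕ.+ l ∸ j) * h (n ∸ (j ℕ.+ l)))) (ℕP.+-∸-assoc 1 j≤n) ⟩
    ∑[ l < suc (n ∸ j) ] (f j * g (j ℕ.+ l ∸ j) * h (n ∸ (j ℕ.+ l)))
      ≡⟨ ∑-cong (suc (n ∸ j)) (λ l _ → cong₂ (λ p q → f j * g p * h q) (ℕP.m+n∸m≡n j l) (sym (ℕP.∸-+-assoc n j l))) ⟩
    ∑[ l < suc (n ∸ j) ] (f j * g l * h (n ∸ j ∸ l))
      ≡⟨ ∑-cong (suc (n ∸ j)) (λ l _ → ℤP.*-assoc (f j) (g l) _) ⟩
    ∑[ l < suc (n ∸ j) ] (f j * (g l * h (n ∸ j ∸ l)))
      ≡⟨ *-distribˡ-∑ (suc (n ∸ j)) (f j) _ ⟨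
    f j * ∑[ l < suc (n ∸ j) ] (g l * h (n ∸ j ∸ l))
      ∎

⊛-comm : ∀ f g → f ⊛ g ≗ g ⊛ f
⊛-comm f g n = trans (∑-reverse (suc n) _) (∑-cong (suc n) λ i i<1+n →
  trans (cong (λ j → f (n ∸ i) * g j) (ℕP.m∸[m∸n]≡n (ℕP.≤-pred i<1+n))) (ℤP.*-comm (f (n ∸ i)) (g i)))

⊛-identityˡ : ∀ f → 𝟙 ⊛ f ≗ f
⊛-identityˡ f n = begin
  (𝟙 ⊛ f) n                                           ≡⟨ ∑-head n _ ⟩
  + 1 * f n + ∑[ i < n ] (𝟙 (suc i) * f (n ∸ suc i))  ≡⟨ cong₂ _+_ (ℤP.*-identityˡ (f n)) (∑-zero n (λ _ _ → refl)) ⟩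
  f n + + 0                                           ≡⟨ ℤP.+-identityʳ (f n) ⟩
  f n                                                 ∎
  where open ≡-Reasoning

⊛-distribʳ : ∀ f g h → (g ⊕ h) ⊛ f ≗ g ⊛ f ⊕ h ⊛ f
⊛-distribʳ f g h n =
  trans (∑-cong (suc n) (λ i _ → ℤP.*-distribʳ-+ (f (n ∸ i)) (g i) (h i))) (∑-distrib-+ (suc n) _ _)

≗-isEquivalence : IsEquivalence (_≗_ {A = ℕ} {B = ℤ})
≗-isEquivalence = record
  { refl  = λ _ → refl
  ; sym   = λ f≗g n → sym (f≗g n)
  ; trans = λ f≗g g≗h n → trans (f≗g n) (g≗h n)
  }

series : CommutativeSemiring 0ℓ 0ℓ
series = record
  { Carrier = Series ; _≈_ = _≗_ ; _+_ = _⊕_ ; _*_ = _⊛_ ; 0# = 𝟘 ; 1# = 𝟙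
  ; isCommutativeSemiring = Biased.IsCommutativeSemiringˡ.isCommutativeSemiring record
    { +-isCommutativeMonoid = record
      { isMonoid = record
        { isSemigroup = record
          { isMagma = record { isEquivalence = ≗-isEquivalence ; ∙-cong = λ p q n → cong₂ _+_ (p n) (q n) }
          ; assoc   = λ f g h n → ℤP.+-assoc (f n) (g n) (h n)
          }
        ; identity = (λ f n → ℤP.+-identityˡ (f n)) , (λ f n → ℤP.+-identityʳ (f n))
        }
      ; comm = λ f g n → ℤP.+-comm (f n) (g n)
      }
    ; *-isCommutativeMonoid = record
      { isMonoid = record
        { isSemigroup = record
          { isMagma = record { isEquivalence = ≗-isEquivalence ; ∙-cong = ⊛-cong }
          ; assoc   = ⊛-assoc
          }
        ; identity = ⊛-identityˡ , (λ f n → trans (⊛-comm f 𝟙 n) (⊛-identityˡ f n))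
        }
      ; comm = ⊛-comm
      }
    ; distribʳ = ⊛-distribʳ
    ; zeroˡ    = λ f n → ∑-zero (suc n) (λ _ _ → refl)
    }
  }

open CommutativeSemiring series using (semiring) renaming (*-identityʳ to ⊛-identityʳ; distribˡ to ⊛-distribˡ)
open import Algebra.Properties.Semiring.Exp semiring using (_^_; ^-congˡ; ^-assocʳ)
open import Algebra.Properties.CommutativeSemiring.Exp series using (^-distrib-*)
open import Algebra.Properties.Semiring.Mult semiring using (×-assoc-*) renaming (_×_ to _·_)
import Algebra.Properties.Semiring.Sum semiring as SeriesSum
import Algebra.Properties.CommutativeSemiring.Binomial series as Binomial

X : Series
X (suc zero) = + 1
X _          = + 0

const : ℤ → Series
const c zero    = c
const c (suc _) = + 0

X-1 : Series
X-1 = X ⊕ const -1ℤ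

const-⊛ : ∀ c p n → (const c ⊛ p) n ≡ c * p n
const-⊛ c p n = begin
  (const c ⊛ p) n                                     ≡⟨ ∑-head n _ ⟩
  c * p n + ∑[ i < n ] (+ 0 * p (n ∸ suc i))           ≡⟨ cong (λ x → c * p n + x) (∑-zero n (λ _ _ → refl)) ⟩
  c * p n + + 0                                       ≡⟨ ℤP.+-identityʳ _ ⟩
  c * p n                                             ∎
  where open ≡-Reasoning

const-^ : ∀ c e → const c ^ e ≗ const (c ℤ.^ e)
const-^ c zero    zero    = refl
const-^ c zero    (suc n) = refl
const-^ c (suc e) n = trans (const-⊛ c (const c ^ e) n) (trans (cong (c *_) (const-^ c e n)) (scale n))
  where
  scale : ∀ n → c * const (c ℤ.^ e) n ≡ const (c ℤ.^ suc e) n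
  scale zero    = refl
  scale (suc n) = ℤP.*-zeroʳ c

𝟙-^ : ∀ e → 𝟙 ^ e ≗ 𝟙
𝟙-^ zero    n = refl
𝟙-^ (suc e) n = trans (⊛-identityˡ (𝟙 ^ e) n) (𝟙-^ e n)

X-⊛-suc : ∀ p n → (X ⊛ p) (suc n) ≡ p n
X-⊛-suc p n = begin
  (X ⊛ p) (suc n)                                              ≡⟨ ∑-head (suc n) _ ⟩
  + 0 + ∑[ i < suc n ] (X (suc i) * p (n ∸ i))                  ≡⟨ ℤP.+-identityˡ _ ⟩
  ∑[ i < suc n ] (X (suc i) * p (n ∸ i))                        ≡⟨ ∑-head n _ ⟩
  + 1 * p n + ∑[ i < n ] (X (suc (suc i)) * p (n ∸ suc i))      ≡⟨ cong₂ _+_ (ℤP.*-identityˡ (p n)) (∑-zero n (λ _ _ → refl)) ⟩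
  p n + + 0                                                    ≡⟨ ℤP.+-identityʳ (p n) ⟩
  p n                                                          ∎
  where open ≡-Reasoning

scale-⊛ : ∀ c F G n → ((λ i → c * F i) ⊛ G) n ≡ c * (F ⊛ G) n
scale-⊛ c F G n =
  trans (∑-cong (suc n) (λ i _ → ℤP.*-assoc c (F i) (G (n ∸ i)))) (sym (*-distribˡ-∑ (suc n) c _))

X^-⊛-+ : ∀ b p i → (X ^ b ⊛ p) (b ℕ.+ i) ≡ p i
X^-⊛-+ zero    p i = ⊛-identityˡ p i
X^-⊛-+ (suc b) p i = trans (⊛-assoc X (X ^ b) p (suc (b ℕ.+ i))) (trans (X-⊛-suc (X ^ b ⊛ p) (b ℕ.+ i)) (X^-⊛-+ b p i))

X^-⊛ : ∀ b p {n} → b ℕ.≤ n → (X ^ b ⊛ p) n ≡ p (n ∸ b)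
X^-⊛ b p b≤n = trans (cong (X ^ b ⊛ p) (sym (ℕP.m+[n∸m]≡n b≤n))) (X^-⊛-+ b p _)

X⊛-^ : ∀ f m {n} → m ℕ.≤ n → ((X ⊛ f) ^ m) n ≡ (f ^ m) (n ∸ m)
X⊛-^ f m {n} m≤n = trans (^-distrib-* X f m n) (X^-⊛ m (f ^ m) m≤n)

X^-coeff : ∀ d s → (X ^ d) s ≡ δ d s
X^-coeff zero    zero    = refl
X^-coeff zero    (suc s) = refl
X^-coeff (suc d) zero    = refl
X^-coeff (suc d) (suc s) = trans (X-⊛-suc (X ^ d) s) (X^-coeff d s)

pascal : ∀ d r → + (suc d C r) ≡ + (d C r) + (X ⊛ (λ j → + (d C j))) r
pascal d zero    = refl
pascal d (suc r) = begin
  + (suc d C suc r)                  ≡⟨ cong +_ (nCk+nC[k+1]≡[n+1]C[k+1] d r) ⟨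
  + (d C r) + + (d C suc r)          ≡⟨ ℤP.+-comm (+ (d C r)) (+ (d C suc r)) ⟩
  + (d C suc r) + + (d C r)          ≡⟨ cong (λ x → + (d C suc r) + x) (X-⊛-suc (λ j → + (d C j)) r) ⟨
  + (d C suc r) + (X ⊛ (λ j → + (d C j))) (suc r) ∎
  where open ≡-Reasoning

1+X^-coeff : ∀ N i → ((𝟙 ⊕ X) ^ N) i ≡ + (N C i)
1+X^-coeff zero    zero    = refl
1+X^-coeff zero    (suc i) = refl
1+X^-coeff (suc N) i = begin
  ((𝟙 ⊕ X) ⊛ (𝟙 ⊕ X) ^ N) i                          ≡⟨ ⊛-distribʳ ((𝟙 ⊕ X) ^ N) 𝟙 X i ⟩
  (𝟙 ⊛ (𝟙 ⊕ X) ^ N) i + (X ⊛ (𝟙 ⊕ X) ^ N) i          ≡⟨ cong₂ _+_ (⊛-identityˡ ((𝟙 ⊕ X) ^ N) i) (⊛-cong {X} (λ _ → refl) (1+X^-coeff N) i) ⟩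
  ((𝟙 ⊕ X) ^ N) i + (X ⊛ (λ j → + (N C j))) i        ≡⟨ cong (_+ (X ⊛ (λ j → + (N C j))) i) (1+X^-coeff N i) ⟩
  + (N C i) + (X ⊛ (λ j → + (N C j))) i               ≡⟨ pascal N i ⟨
  + (suc N C i)                                      ∎
  where open ≡-Reasoning

·-coeff : ∀ m p i → (m · p) i ≡ + m * p i
·-coeff zero    p i = sym (ℤP.*-zeroˡ (p i))
·-coeff (suc m) p i = begin
  p i + (m · p) i         ≡⟨ cong (λ x → p i + x) (·-coeff m p i) ⟩
  p i + + m * p i         ≡⟨ cong (_+ + m * p i) (ℤP.*-identityˡ (p i)) ⟨
  + 1 * p i + + m * p i   ≡⟨ ℤP.*-distribʳ-+ (p i) (+ 1) (+ m) ⟨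
  + suc m * p i           ∎
  where open ≡-Reasoning

sum-coeff : ∀ n (h : ℕ → Series) i → SeriesSum.sum {n} (h ∘ toℕ) i ≡ ∑[ j < n ] h j i
sum-coeff zero    h i = refl
sum-coeff (suc n) h i =
  trans (cong (λ x → h 0 i + x) (sum-coeff n (h ∘ suc) i)) (sym (∑-head n (λ j → h j i)))

binomial-⊛ : ∀ e x y q i →
             ((x ⊕ y) ^ e ⊛ q) i ≡ ∑[ j < suc e ] (+ (e C j) * (x ^ j ⊛ y ^ (e ∸ j) ⊛ q) i)
binomial-⊛ e x y q i = begin
  ((x ⊕ y) ^ e ⊛ q) i                          ≡⟨ ⊛-cong {g = q} (Binomial.theorem e x y) (λ _ → refl) i ⟩
  (Binomial.binomialExpansion x y e ⊛ q) i     ≡⟨ SeriesSum.*-distribʳ-sum q (Binomial.binomialTerm x y e) i ⟩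
  SeriesSum.sum {suc e} (term ∘ toℕ) i         ≡⟨ sum-coeff (suc e) term i ⟩
  ∑[ j < suc e ] term j i                      ≡⟨ ∑-cong (suc e) (λ j _ → trans (×-assoc-* (e C j) _ q i) (·-coeff (e C j) _ i)) ⟩
  ∑[ j < suc e ] (+ (e C j) * (x ^ j ⊛ y ^ (e ∸ j) ⊛ q) i) ∎
  where
  open ≡-Reasoning
  term : ℕ → Series
  term j = (e C j) · (x ^ j ⊛ y ^ (e ∸ j)) ⊛ q

binomial-coeff : ∀ e x y i → ((x ⊕ y) ^ e) i ≡ ∑[ j < suc e ] (+ (e C j) * (x ^ j ⊛ y ^ (e ∸ j)) i)
binomial-coeff e x y i = begin
  ((x ⊕ y) ^ e) i                                        ≡⟨ ⊛-identityʳ ((x ⊕ y) ^ e) i ⟨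
  ((x ⊕ y) ^ e ⊛ 𝟙) i                                    ≡⟨ binomial-⊛ e x y 𝟙 i ⟩
  ∑[ j < suc e ] (+ (e C j) * (x ^ j ⊛ y ^ (e ∸ j) ⊛ 𝟙) i) ≡⟨ ∑-cong (suc e) (λ j _ → cong (+ (e C j) *_) (⊛-identityʳ (x ^ j ⊛ y ^ (e ∸ j)) i)) ⟩
  ∑[ j < suc e ] (+ (e C j) * (x ^ j ⊛ y ^ (e ∸ j)) i)    ∎
  where open ≡-Reasoning

X-1^-coeff : ∀ r s → (X-1 ^ r) s ≡ + (r C s) * -1ℤ ℤ.^ (r ∸ s)
X-1^-coeff r s = begin
  (X-1 ^ r) s                                                   ≡⟨ binomial-coeff r X (const -1ℤ) s ⟩
  ∑[ j < suc r ] (+ (r C j) * (X ^ j ⊛ const -1ℤ ^ (r ∸ j)) s)  ≡⟨ ∑-cong (suc r) (λ j _ → monomial j) ⟩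
  ∑[ j < suc r ] (+ (r C j) * -1ℤ ℤ.^ (r ∸ j) * δ j s)          ≡⟨ ∑-δ (suc r) (λ j → + (r C j) * -1ℤ ℤ.^ (r ∸ j)) s vanish ⟩
  + (r C s) * -1ℤ ℤ.^ (r ∸ s)                                   ∎
  where
  open ≡-Reasoning
  monomial : ∀ j → + (r C j) * (X ^ j ⊛ const -1ℤ ^ (r ∸ j)) s ≡ + (r C j) * -1ℤ ℤ.^ (r ∸ j) * δ j s
  monomial j = begin
    + (r C j) * (X ^ j ⊛ const -1ℤ ^ (r ∸ j)) s            ≡⟨ cong (+ (r C j) *_) (⊛-comm (X ^ j) (const -1ℤ ^ (r ∸ j)) s) ⟩
    + (r C j) * (const -1ℤ ^ (r ∸ j) ⊛ X ^ j) s            ≡⟨ cong (+ (r C j) *_) (⊛-cong {g = X ^ j} (const-^ -1ℤ (r ∸ j)) (λ _ → refl) s) ⟩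
    + (r C j) * (const (-1ℤ ℤ.^ (r ∸ j)) ⊛ X ^ j) s        ≡⟨ cong (+ (r C j) *_) (const-⊛ _ (X ^ j) s) ⟩
    + (r C j) * (-1ℤ ℤ.^ (r ∸ j) * (X ^ j) s)              ≡⟨ cong (λ x → + (r C j) * (-1ℤ ℤ.^ (r ∸ j) * x)) (X^-coeff j s) ⟩
    + (r C j) * (-1ℤ ℤ.^ (r ∸ j) * δ j s)                  ≡⟨ ℤP.*-assoc (+ (r C j)) _ _ ⟨
    + (r C j) * -1ℤ ℤ.^ (r ∸ j) * δ j s                    ∎
  vanish : suc r ℕ.≤ s → + (r C s) * -1ℤ ℤ.^ (r ∸ s) ≡ + 0
  vanish r<s = cong (λ c → + c * -1ℤ ℤ.^ (r ∸ s)) (k>n⇒nCk≡0 r<s)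

X≗X-1⊕𝟙 : X ≗ X-1 ⊕ 𝟙
X≗X-1⊕𝟙 zero          = refl
X≗X-1⊕𝟙 (suc zero)    = refl
X≗X-1⊕𝟙 (suc (suc n)) = refl

binomial-inversion : ∀ {d R} s → d ℕ.≤ R → δ d s ≡ ∑[ r < suc R ] (+ (d C r) * (X-1 ^ r) s)
binomial-inversion {d} {R} s d≤R = begin
  δ d s                                                   ≡⟨ X^-coeff d s ⟨
  (X ^ d) s                                               ≡⟨ ^-congˡ d X≗X-1⊕𝟙 s ⟩
  ((X-1 ⊕ 𝟙) ^ d) s                                       ≡⟨ binomial-coeff d X-1 𝟙 s ⟩
  ∑[ r < suc d ] (+ (d C r) * (X-1 ^ r ⊛ 𝟙 ^ (d ∸ r)) s)  ≡⟨ ∑-cong (suc d) (λ r _ → cong (+ (d C r) *_) (drop-𝟙 r)) ⟩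
  ∑[ r < suc d ] (+ (d C r) * (X-1 ^ r) s)                ≡⟨ ∑-truncate (s≤s d≤R) vanish ⟨
  ∑[ r < suc R ] (+ (d C r) * (X-1 ^ r) s)                ∎
  where
  open ≡-Reasoning
  drop-𝟙 : ∀ r → (X-1 ^ r ⊛ 𝟙 ^ (d ∸ r)) s ≡ (X-1 ^ r) s
  drop-𝟙 r = trans (⊛-cong {X-1 ^ r} (λ _ → refl) (𝟙-^ (d ∸ r)) s) (⊛-identityʳ (X-1 ^ r) s)
  vanish : ∀ r → suc d ℕ.≤ r → r ℕ.< suc R → + (d C r) * (X-1 ^ r) s ≡ + 0
  vanish r d<r _ = cong (λ c → + c * (X-1 ^ r) s) (k>n⇒nCk≡0 d<r)

geometricSum : ℕ → Series
geometricSum j i = ∑[ l < j ] ((𝟙 ⊕ X) ^ l) i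

geometric : ∀ j → 𝟙 ⊕ X ⊛ geometricSum j ≗ (𝟙 ⊕ X) ^ j
geometric zero    i = trans (cong (λ x → 𝟙 i + x) (∑-zero (suc i) (λ l _ → ℤP.*-zeroʳ (X l)))) (ℤP.+-identityʳ (𝟙 i))
geometric (suc j) i = begin
  𝟙 i + (X ⊛ (geometricSum j ⊕ (𝟙 ⊕ X) ^ j)) i              ≡⟨ cong (λ x → 𝟙 i + x) (⊛-distribˡ X (geometricSum j) ((𝟙 ⊕ X) ^ j) i) ⟩
  𝟙 i + ((X ⊛ geometricSum j) i + (X ⊛ (𝟙 ⊕ X) ^ j) i)      ≡⟨ ℤP.+-assoc (𝟙 i) _ _ ⟨
  𝟙 i + (X ⊛ geometricSum j) i + (X ⊛ (𝟙 ⊕ X) ^ j) i        ≡⟨ cong (_+ (X ⊛ (𝟙 ⊕ X) ^ j) i) (geometric j i) ⟩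
  ((𝟙 ⊕ X) ^ j) i + (X ⊛ (𝟙 ⊕ X) ^ j) i                     ≡⟨ cong (_+ (X ⊛ (𝟙 ⊕ X) ^ j) i) (⊛-identityˡ ((𝟙 ⊕ X) ^ j) i) ⟨
  (𝟙 ⊛ (𝟙 ⊕ X) ^ j) i + (X ⊛ (𝟙 ⊕ X) ^ j) i                 ≡⟨ ⊛-distribʳ ((𝟙 ⊕ X) ^ j) 𝟙 X i ⟨
  ((𝟙 ⊕ X) ^ suc j) i                                       ∎
  where open ≡-Reasoning

-- Sums over lists, letters and words

∑ˡ : {A : Set} → List A → (A → ℤ) → ℤ
∑ˡ []       f = + 0
∑ˡ (x ∷ xs) f = f x + ∑ˡ xs f

syntax ∑ˡ xs (λ x → e) = ∑ˡ[ x ∈ xs ] e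

module _ {A : Set} where

  ∑ˡ-cong : ∀ (xs : List A) {f g : A → ℤ} → f ≗ g → ∑ˡ xs f ≡ ∑ˡ xs g
  ∑ˡ-cong []       f≗g = refl
  ∑ˡ-cong (x ∷ xs) f≗g = cong₂ _+_ (f≗g x) (∑ˡ-cong xs f≗g)

  ∑ˡ-zero : ∀ (xs : List A) {f : A → ℤ} → (∀ x → f x ≡ + 0) → ∑ˡ xs f ≡ + 0
  ∑ˡ-zero []       f≡0 = refl
  ∑ˡ-zero (x ∷ xs) f≡0 = cong₂ _+_ (f≡0 x) (∑ˡ-zero xs f≡0)

  ∑ˡ-++ : ∀ (xs ys : List A) f → ∑ˡ (xs ++ ys) f ≡ ∑ˡ xs f + ∑ˡ ys f
  ∑ˡ-++ []       ys f = sym (ℤP.+-identityˡ _)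
  ∑ˡ-++ (x ∷ xs) ys f = trans (cong (λ s → f x + s) (∑ˡ-++ xs ys f)) (sym (ℤP.+-assoc (f x) _ _))

  ∑ˡ-distrib-+ : ∀ (xs : List A) f g → ∑ˡ[ x ∈ xs ] (f x + g x) ≡ ∑ˡ xs f + ∑ˡ xs g
  ∑ˡ-distrib-+ []       f g = refl
  ∑ˡ-distrib-+ (x ∷ xs) f g =
    trans (cong (λ s → f x + g x + s) (∑ˡ-distrib-+ xs f g)) (interchange (f x) (g x) (∑ˡ xs f) (∑ˡ xs g))

  *-distribˡ-∑ˡ : ∀ (xs : List A) c f → c * ∑ˡ xs f ≡ ∑ˡ[ x ∈ xs ] (c * f x)
  *-distribˡ-∑ˡ []       c f = ℤP.*-zeroʳ c
  *-distribˡ-∑ˡ (x ∷ xs) c f =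
    trans (ℤP.*-distribˡ-+ c (f x) (∑ˡ xs f)) (cong (λ s → c * f x + s) (*-distribˡ-∑ˡ xs c f))

  *-distribʳ-∑ˡ : ∀ (xs : List A) c f → ∑ˡ xs f * c ≡ ∑ˡ[ x ∈ xs ] (f x * c)
  *-distribʳ-∑ˡ xs c f =
    trans (ℤP.*-comm (∑ˡ xs f) c) (trans (*-distribˡ-∑ˡ xs c f) (∑ˡ-cong xs (λ x → ℤP.*-comm c (f x))))

  ∑ˡ-∑ : ∀ (xs : List A) n (F : A → ℕ → ℤ) → ∑ˡ[ x ∈ xs ] ∑[ i < n ] F x i ≡ ∑[ i < n ] ∑ˡ[ x ∈ xs ] F x i
  ∑ˡ-∑ xs zero    F = ∑ˡ-zero xs (λ _ → refl)
  ∑ˡ-∑ xs (suc n) F =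
    trans (∑ˡ-distrib-+ xs (λ x → ∑ n (F x)) (λ x → F x n)) (cong (_+ ∑ˡ[ x ∈ xs ] F x n) (∑ˡ-∑ xs n F))

  ∑ˡ-⊛ : ∀ (xs : List A) (F : A → Series) G n → ((λ i → ∑ˡ[ x ∈ xs ] F x i) ⊛ G) n ≡ ∑ˡ[ x ∈ xs ] (F x ⊛ G) n
  ∑ˡ-⊛ xs F G n = trans (∑-cong (suc n) (λ i _ → *-distribʳ-∑ˡ xs (G (n ∸ i)) (λ x → F x i)))
                        (sym (∑ˡ-∑ xs (suc n) (λ x i → F x i * G (n ∸ i))))

  ⊛-∑ˡ : ∀ (xs : List A) (F : A → Series) G n → (G ⊛ (λ i → ∑ˡ[ x ∈ xs ] F x i)) n ≡ ∑ˡ[ x ∈ xs ] (G ⊛ F x) n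
  ⊛-∑ˡ xs F G n = trans (⊛-comm G (λ i → ∑ˡ[ x ∈ xs ] F x i) n) (trans (∑ˡ-⊛ xs F G n) (∑ˡ-cong xs (λ x → ⊛-comm (F x) G n)))

  count≡∑ˡδ : ∀ (xs : List A) (f : A → ℕ) s → + length (filter (λ x → f x ℕ.≟ s) xs) ≡ ∑ˡ[ x ∈ xs ] δ (f x) s
  count≡∑ˡδ []       f s = refl
  count≡∑ˡδ (x ∷ xs) f s with f x ℕ.≡ᵇ s
  ... | true  = cong (λ c → + 1 + c) (count≡∑ˡδ xs f s)
  ... | false = trans (count≡∑ˡδ xs f s) (sym (ℤP.+-identityˡ _))

  ∑ˡ-tabulate : ∀ n (g : Fin n → A) f → ∑ˡ (tabulate g) f ≡ ∑ᶠ (f ∘ g)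
  ∑ˡ-tabulate zero    g f = refl
  ∑ˡ-tabulate (suc n) g f = cong (λ s → f (g Fin.zero) + s) (∑ˡ-tabulate n (g ∘ Fin.suc) f)

  ∑ˡδ≡∑-binomialMoments : ∀ (xs : List A) (f : A → ℕ) {R} s → (∀ x → f x ℕ.≤ R) →
    ∑ˡ[ x ∈ xs ] δ (f x) s ≡ ∑[ r < suc R ] (∑ˡ[ x ∈ xs ] (+ (f x C r)) * (X-1 ^ r) s)
  ∑ˡδ≡∑-binomialMoments xs f {R} s f≤R = begin
    ∑ˡ[ x ∈ xs ] δ (f x) s                                         ≡⟨ ∑ˡ-cong xs (λ x → binomial-inversion s (f≤R x)) ⟩
    ∑ˡ[ x ∈ xs ] ∑[ r < suc R ] (+ (f x C r) * (X-1 ^ r) s)        ≡⟨ ∑ˡ-∑ xs (suc R) _ ⟩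
    ∑[ r < suc R ] ∑ˡ[ x ∈ xs ] (+ (f x C r) * (X-1 ^ r) s)        ≡⟨ ∑-cong (suc R) (λ r _ → *-distribʳ-∑ˡ xs _ _) ⟨
    ∑[ r < suc R ] (∑ˡ[ x ∈ xs ] (+ (f x C r)) * (X-1 ^ r) s)      ∎
    where open ≡-Reasoning

module _ {A B : Set} where

  ∑ˡ-map : ∀ (g : A → B) xs f → ∑ˡ (map g xs) f ≡ ∑ˡ[ x ∈ xs ] f (g x)
  ∑ˡ-map g []       f = refl
  ∑ˡ-map g (x ∷ xs) f = cong (λ s → f (g x) + s) (∑ˡ-map g xs f)

  ∑ˡ-concatMap : ∀ (g : A → List B) xs f → ∑ˡ (concatMap g xs) f ≡ ∑ˡ[ x ∈ xs ] ∑ˡ (g x) f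
  ∑ˡ-concatMap g []       f = refl
  ∑ˡ-concatMap g (x ∷ xs) f = trans (∑ˡ-++ (g x) _ f) (cong (λ s → ∑ˡ (g x) f + s) (∑ˡ-concatMap g xs f))

∑ᶠ-toℕ : ∀ n (h : ℕ → ℤ) → ∑ᶠ {n} (h ∘ toℕ) ≡ ∑ n h
∑ᶠ-toℕ zero    h = refl
∑ᶠ-toℕ (suc n) h = trans (cong (λ s → h 0 + s) (∑ᶠ-toℕ n (h ∘ suc))) (sym (∑-head n h))

∑ˡ-allFin : ∀ n (h : ℕ → ℤ) → ∑ˡ[ a ∈ allFin n ] h (toℕ a) ≡ ∑ n h
∑ˡ-allFin n h = trans (∑ˡ-tabulate n (λ a → a) (h ∘ toℕ)) (∑ᶠ-toℕ n h)

∑ˡ-allFin-opposite : ∀ n (g : Fin n → ℤ) → ∑ˡ[ a ∈ allFin n ] g (opposite a) ≡ ∑ˡ (allFin n) g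
∑ˡ-allFin-opposite n g = begin
  ∑ˡ[ a ∈ allFin n ] g (opposite a)   ≡⟨ ∑ˡ-tabulate n (λ a → a) (g ∘ opposite) ⟩
  ∑ᶠ (g ∘ opposite)                   ≡⟨ ∑-permute g Permutation.reverse ⟨
  ∑ᶠ g                                ≡⟨ ∑ˡ-tabulate n (λ a → a) g ⟨
  ∑ˡ (allFin n) g                     ∎
  where open ≡-Reasoning

∑ˡ-allWords-suc : ∀ k n (f : Word k (suc n) → ℤ) →
                  ∑ˡ (allWords k (suc n)) f ≡ ∑ˡ[ a ∈ allFin k ] ∑ˡ[ w ∈ allWords k n ] f (a ∷ w)
∑ˡ-allWords-suc k n f =
  trans (∑ˡ-concatMap _ (allFin k) f) (∑ˡ-cong (allFin k) (λ a → ∑ˡ-map (a ∷_) (allWords k n) f))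

∑ˡ-allWords-relabel : ∀ {k} (σ : Fin k → Fin k) → (∀ g → ∑ˡ[ a ∈ allFin k ] g (σ a) ≡ ∑ˡ (allFin k) g) →
                      ∀ n (f : Word k n → ℤ) → ∑ˡ[ w ∈ allWords k n ] f (Vec.map σ w) ≡ ∑ˡ (allWords k n) f
∑ˡ-allWords-relabel σ σ-permutes zero    f = refl
∑ˡ-allWords-relabel {k} σ σ-permutes (suc n) f = begin
  ∑ˡ[ w ∈ allWords k (suc n) ] f (Vec.map σ w)                    ≡⟨ ∑ˡ-allWords-suc k n (f ∘ Vec.map σ) ⟩
  ∑ˡ[ a ∈ allFin k ] ∑ˡ[ w ∈ allWords k n ] f (σ a ∷ Vec.map σ w) ≡⟨ ∑ˡ-cong (allFin k) (λ a → ∑ˡ-allWords-relabel σ σ-permutes n (f ∘ (σ a ∷_))) ⟩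
  ∑ˡ[ a ∈ allFin k ] ∑ˡ[ w ∈ allWords k n ] f (σ a ∷ w)           ≡⟨ σ-permutes (λ b → ∑ˡ[ w ∈ allWords k n ] f (b ∷ w)) ⟩
  ∑ˡ[ a ∈ allFin k ] ∑ˡ[ w ∈ allWords k n ] f (a ∷ w)             ≡⟨ ∑ˡ-allWords-suc k n f ⟨
  ∑ˡ (allWords k (suc n)) f                                       ∎
  where open ≡-Reasoning

-- Marked adjacent pairs and their binomial moments

pairCount : ∀ {k n} → (Fin k → Fin k → Bool) → Word k n → ℕ
pairCount e []          = 0
pairCount e (a ∷ [])    = 0
pairCount e (a ∷ b ∷ w) = indicator (e a b) ℕ.+ pairCount e (b ∷ w)

desX≡pairCount : ∀ {k n} X (w : Word k n) → desX X w ≡ pairCount (λ a b → ⌊ val b ℕ.<? val a ⌋ ∧ X (val a)) w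
desX≡pairCount X []          = refl
desX≡pairCount X (a ∷ [])    = refl
desX≡pairCount X (a ∷ b ∷ w) = cong (indicator _ ℕ.+_) (desX≡pairCount X (b ∷ w))

risX≡pairCount : ∀ {k n} X (w : Word k n) → risX X w ≡ pairCount (λ a b → ⌊ val a ℕ.<? val b ⌋ ∧ X (val a)) w
risX≡pairCount X []          = refl
risX≡pairCount X (a ∷ [])    = refl
risX≡pairCount X (a ∷ b ∷ w) = cong (indicator _ ℕ.+_) (risX≡pairCount X (b ∷ w))

indicator≤1 : ∀ x → indicator x ℕ.≤ 1
indicator≤1 true  = s≤s z≤n
indicator≤1 false = z≤n

pairCount-∷-≤ : ∀ {k n} e a (w : Word k n) → pairCount e (a ∷ w) ℕ.≤ n
pairCount-∷-≤ e a []      = z≤n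
pairCount-∷-≤ e a (b ∷ w) = ℕP.+-mono-≤ (indicator≤1 (e a b)) (pairCount-∷-≤ e b w)

pairCount-≤ : ∀ {k n} e (w : Word k n) → pairCount e w ℕ.≤ n
pairCount-≤ e []      = z≤n
pairCount-≤ e (a ∷ w) = ℕP.m≤n⇒m≤1+n (pairCount-∷-≤ e a w)

pairCount-relabel : ∀ {k n} {e e′ : Fin k → Fin k → Bool} (σ : Fin k → Fin k) →
                    (∀ a b → e (σ a) (σ b) ≡ e′ a b) → (w : Word k n) → pairCount e (Vec.map σ w) ≡ pairCount e′ w
pairCount-relabel σ e∘σ≡e′ []          = refl
pairCount-relabel σ e∘σ≡e′ (a ∷ [])    = refl
pairCount-relabel σ e∘σ≡e′ (a ∷ b ∷ w) =
  cong₂ (λ x y → indicator x ℕ.+ y) (e∘σ≡e′ a b) (pairCount-relabel σ e∘σ≡e′ (b ∷ w))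

pascal-indicator : ∀ x d r → + ((indicator x ℕ.+ d) C r) ≡ + (d C r) + + indicator x * (X ⊛ (λ j → + (d C j))) r
pascal-indicator false d r = sym (ℤP.+-identityʳ _)
pascal-indicator true  d r = trans (pascal d r) (cong (λ x → + (d C r) + x) (sym (ℤP.*-identityˡ ((X ⊛ (λ j → + (d C j))) r))))

markedSum : ∀ {k} → (Fin k → Fin k → Bool) → (Fin k → Series) → Fin k → Series
markedSum {k} e P a i = ∑ˡ[ b ∈ allFin k ] (+ indicator (e a b) * P b i)

module Transfer {k : ℕ} (e : Fin k → Fin k → Bool) (P : Fin k → Series) (P-step : ∀ a → P a ≗ 𝟙 ⊕ X ⊛ markedSum e P a)
  where

  Q : Fin k → Series
  Q = markedSum e P

  B : Series
  B i = ∑ˡ[ b ∈ allFin k ] P b i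

  moment : ℕ → Fin k → ℕ → ℤ
  moment n a r = ∑ˡ[ w ∈ allWords k n ] (+ (pairCount e (a ∷ w) C r))

  moment-suc : ∀ n a r →
    moment (suc n) a r ≡ ∑ˡ[ b ∈ allFin k ] (moment n b r + + indicator (e a b) * (X ⊛ moment n b) r)
  moment-suc n a r = trans (∑ˡ-allWords-suc k n _) (∑ˡ-cong (allFin k) by-second-letter)
    where
    open ≡-Reasoning
    by-second-letter : ∀ b → ∑ˡ[ w ∈ allWords k n ] (+ ((indicator (e a b) ℕ.+ pairCount e (b ∷ w)) C r))
                     ≡ moment n b r + + indicator (e a b) * (X ⊛ moment n b) r
    by-second-letter b = begin
      ∑ˡ[ w ∈ Ws ] (+ ((c ℕ.+ d w) C r))                                ≡⟨ ∑ˡ-cong Ws (λ w → pascal-indicator (e a b) (d w) r) ⟩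
      ∑ˡ[ w ∈ Ws ] (+ (d w C r) + + c * (X ⊛ row w) r)                   ≡⟨ ∑ˡ-distrib-+ Ws _ _ ⟩
      moment n b r + ∑ˡ[ w ∈ Ws ] (+ c * (X ⊛ row w) r)                  ≡⟨ cong (λ x → moment n b r + x) (*-distribˡ-∑ˡ Ws (+ c) _) ⟨
      moment n b r + + c * ∑ˡ[ w ∈ Ws ] (X ⊛ row w) r                    ≡⟨ cong (λ x → moment n b r + + c * x) (⊛-∑ˡ Ws row X r) ⟨
      moment n b r + + c * (X ⊛ moment n b) r                            ∎
      where
      Ws = allWords k n
      c = indicator (e a b)
      d : Word k n → ℕ
      d w = pairCount e (b ∷ w)
      row : Word k n → Series
      row w j = + (d w C j)

  moment-vanish : ∀ n a r → n ℕ.< r → moment n a r ≡ + 0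
  moment-vanish n a r n<r = ∑ˡ-zero (allWords k n)
    (λ w → cong +_ (k>n⇒nCk≡0 (ℕP.≤-<-trans (pairCount-∷-≤ e a w) n<r)))

  -- For r > n the moment vanishes (moment-vanish), while n ∸ r would truncate to 0.
  moment-closed : ∀ n a r → r ℕ.≤ n → moment n a r ≡ (P a ⊛ B ^ (n ∸ r)) r
  ∑ˡ-moment : ∀ n r → r ℕ.≤ suc n → ∑ˡ[ b ∈ allFin k ] moment n b r ≡ (B ^ (suc n ∸ r)) r
  ∑ˡ-marked-moment : ∀ n a r → r ℕ.≤ suc n →
    ∑ˡ[ b ∈ allFin k ] (+ indicator (e a b) * (X ⊛ moment n b) r) ≡ ((X ⊛ Q a) ⊛ B ^ (suc n ∸ r)) r

  moment-closed zero    a zero    _ = sym (trans (⊛-identityʳ (P a) 0) (P-step a 0))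
  moment-closed zero    a (suc r) ()
  moment-closed (suc n) a r r≤1+n = begin
    moment (suc n) a r
      ≡⟨ moment-suc n a r ⟩
    ∑ˡ[ b ∈ allFin k ] (moment n b r + + indicator (e a b) * (X ⊛ moment n b) r)
      ≡⟨ ∑ˡ-distrib-+ (allFin k) _ _ ⟩
    ∑ˡ[ b ∈ allFin k ] moment n b r + ∑ˡ[ b ∈ allFin k ] (+ indicator (e a b) * (X ⊛ moment n b) r)
      ≡⟨ cong₂ _+_ (∑ˡ-moment n r r≤1+n) (∑ˡ-marked-moment n a r r≤1+n) ⟩
    (B ^ (suc n ∸ r)) r + ((X ⊛ Q a) ⊛ Y) r
      ≡⟨ cong (_+ ((X ⊛ Q a) ⊛ Y) r) (⊛-identityˡ Y r) ⟨
    (𝟙 ⊛ Y) r + ((X ⊛ Q a) ⊛ Y) r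
      ≡⟨ ⊛-distribʳ Y 𝟙 (X ⊛ Q a) r ⟨
    ((𝟙 ⊕ X ⊛ Q a) ⊛ Y) r
      ≡⟨ ⊛-cong {g = Y} (P-step a) (λ _ → refl) r ⟨
    (P a ⊛ Y) r
      ∎
    where
    open ≡-Reasoning
    Y = B ^ (suc n ∸ r)

  ∑ˡ-moment n r r≤1+n with ℕP.m≤n⇒m<n∨m≡n r≤1+n
  ... | inj₁ r<1+n = begin
    ∑ˡ[ b ∈ allFin k ] moment n b r                ≡⟨ ∑ˡ-cong (allFin k) (λ b → moment-closed n b r r≤n) ⟩
    ∑ˡ[ b ∈ allFin k ] (P b ⊛ B ^ (n ∸ r)) r       ≡⟨ ∑ˡ-⊛ (allFin k) P (B ^ (n ∸ r)) r ⟨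
    (B ^ suc (n ∸ r)) r                            ≡⟨ cong (λ m → (B ^ m) r) (ℕP.+-∸-assoc 1 r≤n) ⟨
    (B ^ (suc n ∸ r)) r                            ∎
    where
    open ≡-Reasoning
    r≤n = ℕP.≤-pred r<1+n
  ... | inj₂ refl = begin
    ∑ˡ[ b ∈ allFin k ] moment n b (suc n)          ≡⟨ ∑ˡ-zero (allFin k) (λ b → moment-vanish n b (suc n) ℕP.≤-refl) ⟩
    + 0                                            ≡⟨ cong (λ m → (B ^ m) (suc n)) (ℕP.n∸n≡0 n) ⟨
    (B ^ (n ∸ n)) (suc n)                          ∎
    where open ≡-Reasoning

  ∑ˡ-marked-moment n a zero    _ =
    trans (∑ˡ-zero (allFin k) (λ b → ℤP.*-zeroʳ (+ indicator (e a b)))) (sym (⊛-assoc X (Q a) (B ^ suc n) 0))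
  ∑ˡ-marked-moment n a (suc r) r<1+n = begin
    ∑ˡ[ b ∈ allFin k ] (+ c b * (X ⊛ moment n b) (suc r))   ≡⟨ ∑ˡ-cong (allFin k) (λ b → cong (+ c b *_) (shift b)) ⟩
    ∑ˡ[ b ∈ allFin k ] (+ c b * (P b ⊛ Y) r)                ≡⟨ ∑ˡ-cong (allFin k) (λ b → scale-⊛ (+ c b) (P b) Y r) ⟨
    ∑ˡ[ b ∈ allFin k ] ((λ i → + c b * P b i) ⊛ Y) r        ≡⟨ ∑ˡ-⊛ (allFin k) (λ b i → + c b * P b i) Y r ⟨
    (Q a ⊛ Y) r                                             ≡⟨ X-⊛-suc (Q a ⊛ Y) r ⟨
    (X ⊛ (Q a ⊛ Y)) (suc r)                                 ≡⟨ ⊛-assoc X (Q a) Y (suc r) ⟨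
    ((X ⊛ Q a) ⊛ Y) (suc r)                                 ∎
    where
    open ≡-Reasoning
    Y = B ^ (n ∸ r)
    c : Fin k → ℕ
    c b = indicator (e a b)
    shift : ∀ b → (X ⊛ moment n b) (suc r) ≡ (P b ⊛ Y) r
    shift b = trans (X-⊛-suc (moment n b) r) (moment-closed n b r (ℕP.≤-pred r<1+n))

  wordMoment-closed : ∀ n r → r ℕ.≤ n → ∑ˡ[ w ∈ allWords k n ] (+ (pairCount e w C r)) ≡ (B ^ (n ∸ r)) r
  wordMoment-closed zero    zero    _     = refl
  wordMoment-closed zero    (suc r) ()
  wordMoment-closed (suc n) r       r≤1+n = trans (∑ˡ-allWords-suc k n _) (∑ˡ-moment n r r≤1+n)

-- Descents and rises

⌊⌋-true : ∀ {P : Set} (P? : Dec P) → P → ⌊ P? ⌋ ≡ true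
⌊⌋-true P? p = trans (isYes≗does P?) (dec-true P? p)

⌊⌋-false : ∀ {P : Set} (P? : Dec P) → ¬ P → ⌊ P? ⌋ ≡ false
⌊⌋-false P? ¬p = trans (isYes≗does P?) (dec-false P? ¬p)

⌊⌋-⇔ : ∀ {P R : Set} → P ⇔ R → (P? : Dec P) (R? : Dec R) → ⌊ P? ⌋ ≡ ⌊ R? ⌋
⌊⌋-⇔ P⇔R P? R? = trans (isYes≗does P?) (trans (does-⇔ P⇔R P? R?) (sym (isYes≗does R?)))

XB : ℕ → ℕ → Series
XB c t = (𝟙 ⊕ X) ^ t ⊕ (const (+ c) ⊛ X ⊕ const -1ℤ)

module Descents (k t : ℕ) where

  descent : Fin k → Fin k → Bool
  descent a b = ⌊ val b ℕ.<? val a ⌋ ∧ inInitial t (val a)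

  weight : ℕ → Series
  weight j with j ℕ.<? t
  ... | yes _ = (𝟙 ⊕ X) ^ j
  ... | no  _ = 𝟙

  weight-< : ∀ {j} → j ℕ.< t → weight j ≡ (𝟙 ⊕ X) ^ j
  weight-< {j} j<t with j ℕ.<? t
  ... | yes _   = refl
  ... | no  j≮t = ⊥-elim (j≮t j<t)

  weight-≮ : ∀ {j} → ¬ j ℕ.< t → weight j ≡ 𝟙
  weight-≮ {j} j≮t with j ℕ.<? t
  ... | yes j<t = ⊥-elim (j≮t j<t)
  ... | no  _   = refl

  lowerWeights : Fin k → Series
  lowerWeights = markedSum descent (weight ∘ toℕ)

  lowerWeights-< : ∀ a → toℕ a ℕ.< t → lowerWeights a ≗ geometricSum (toℕ a)
  lowerWeights-< a j<t i = begin
    lowerWeights a i      ≡⟨ ∑ˡ-allFin k term′ ⟩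
    ∑[ l < k ] term′ l    ≡⟨ ∑-cong k (λ l _ → cong (λ x → + indicator (⌊ suc l ℕ.<? suc j ⌋ ∧ x) * weight l i) (⌊⌋-true (j ℕ.<? t) j<t)) ⟩
    ∑[ l < k ] term l     ≡⟨ ∑-truncate (ℕP.<⇒≤ (FinP.toℕ<n a)) above ⟩
    ∑[ l < j ] term l     ≡⟨ ∑-cong j below ⟩
    geometricSum j i      ∎
    where
    open ≡-Reasoning
    j = toℕ a
    term′ term : ℕ → ℤ
    term′ l = + indicator (⌊ suc l ℕ.<? suc j ⌋ ∧ ⌊ j ℕ.<? t ⌋) * weight l i
    term  l = + indicator (⌊ suc l ℕ.<? suc j ⌋ ∧ true) * weight l i
    below : ∀ l → l ℕ.< j → term l ≡ ((𝟙 ⊕ X) ^ l) i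
    below l l<j rewrite ⌊⌋-true (suc l ℕ.<? suc j) (s≤s l<j) | weight-< (ℕP.<-trans l<j j<t) =
      ℤP.*-identityˡ _
    above : ∀ l → j ℕ.≤ l → l ℕ.< k → term l ≡ + 0
    above l j≤l _ rewrite ⌊⌋-false (suc l ℕ.<? suc j) (ℕP.≤⇒≯ (s≤s j≤l)) = refl

  lowerWeights-≮ : ∀ a → ¬ toℕ a ℕ.< t → lowerWeights a ≗ 𝟘
  lowerWeights-≮ a j≮t i = ∑ˡ-zero (allFin k) λ b → trans
    (cong (λ x → + indicator (⌊ val b ℕ.<? val a ⌋ ∧ x) * weight (toℕ b) i) (⌊⌋-false (toℕ a ℕ.<? t) j≮t))
    (cong (λ x → + indicator x * weight (toℕ b) i) (∧-zeroʳ ⌊ val b ℕ.<? val a ⌋))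

  weight-step : ∀ a → weight (toℕ a) ≗ 𝟙 ⊕ X ⊛ lowerWeights a
  weight-step a = by-cases (toℕ a ℕ.<? t)
    where
    by-cases : Dec (toℕ a ℕ.< t) → weight (toℕ a) ≗ 𝟙 ⊕ X ⊛ lowerWeights a
    by-cases (yes j<t) i = begin
      weight (toℕ a) i                         ≡⟨ cong (λ p → p i) (weight-< j<t) ⟩
      ((𝟙 ⊕ X) ^ toℕ a) i                      ≡⟨ geometric (toℕ a) i ⟨
      𝟙 i + (X ⊛ geometricSum (toℕ a)) i       ≡⟨ cong (λ x → 𝟙 i + x) (⊛-cong {X} (λ _ → refl) (λ i → sym (lowerWeights-< a j<t i)) i) ⟩
      𝟙 i + (X ⊛ lowerWeights a) i             ∎
      where open ≡-Reasoning
    by-cases (no j≮t) i = begin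
      weight (toℕ a) i                         ≡⟨ cong (λ p → p i) (weight-≮ j≮t) ⟩
      𝟙 i                                      ≡⟨ ℤP.+-identityʳ (𝟙 i) ⟨
      𝟙 i + + 0                                ≡⟨ cong (λ x → 𝟙 i + x) (∑-zero (suc i) (λ l _ → trans (cong (X l *_) (lowerWeights-≮ a j≮t (i ∸ l))) (ℤP.*-zeroʳ (X l)))) ⟨
      𝟙 i + (X ⊛ lowerWeights a) i             ∎
      where open ≡-Reasoning

  open Transfer descent (weight ∘ toℕ) weight-step using (B; wordMoment-closed)

  B-closed : t ℕ.≤ k → B ≗ geometricSum t ⊕ const (+ (k ∸ t))
  B-closed t≤k i = begin
    B i                                                          ≡⟨ ∑ˡ-allFin k (λ j → weight j i) ⟩
    ∑[ j < k ] weight j i                                        ≡⟨ cong (λ m → ∑[ j < m ] weight j i) (ℕP.m+[n∸m]≡n t≤k) ⟨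
    ∑[ j < t ℕ.+ (k ∸ t) ] weight j i                            ≡⟨ ∑-split t (k ∸ t) (λ j → weight j i) ⟩
    ∑[ j < t ] weight j i + ∑[ l < k ∸ t ] weight (t ℕ.+ l) i    ≡⟨ cong₂ _+_ (∑-cong t (λ j j<t → cong (λ p → p i) (weight-< j<t)))
                                                                              (∑-cong (k ∸ t) (λ l _ → cong (λ p → p i) (weight-≮ (ℕP.m+n≮m t l)))) ⟩
    geometricSum t i + ∑[ _ < k ∸ t ] 𝟙 i                        ≡⟨ cong (λ x → geometricSum t i + x) (∑-const (k ∸ t) (𝟙 i)) ⟩
    geometricSum t i + + (k ∸ t) * 𝟙 i                           ≡⟨ cong (λ x → geometricSum t i + x) (scaled-𝟙 i) ⟩
    geometricSum t i + const (+ (k ∸ t)) i                       ∎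
    where
    open ≡-Reasoning
    scaled-𝟙 : ∀ i → + (k ∸ t) * 𝟙 i ≡ const (+ (k ∸ t)) i
    scaled-𝟙 zero    = ℤP.*-identityʳ (+ (k ∸ t))
    scaled-𝟙 (suc i) = ℤP.*-zeroʳ (+ (k ∸ t))

  X⊛B≗XB : t ℕ.≤ k → X ⊛ B ≗ XB (k ∸ t) t
  X⊛B≗XB t≤k i = begin
    (X ⊛ B) i                                  ≡⟨ ⊛-cong {X} (λ _ → refl) (B-closed t≤k) i ⟩
    (X ⊛ (G ⊕ c)) i                            ≡⟨ ⊛-distribˡ X G c i ⟩
    (X ⊛ G) i + (X ⊛ c) i                      ≡⟨ cong (λ x → (X ⊛ G) i + x) (⊛-comm X c i) ⟩
    (X ⊛ G) i + (c ⊛ X) i                      ≡⟨ regroup (𝟙 i) ((X ⊛ G) i) ((c ⊛ X) i) ⟩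
    𝟙 i + (X ⊛ G) i + ((c ⊛ X) i + - 𝟙 i)      ≡⟨ cong₂ (λ x y → x + ((c ⊛ X) i + y)) (geometric t i) (-𝟙 i) ⟩
    XB (k ∸ t) t i                             ∎
    where
    open ≡-Reasoning
    G = geometricSum t
    c = const (+ (k ∸ t))
    regroup : ∀ o x y → x + y ≡ o + x + (y + - o)
    regroup = solve-∀
    -𝟙 : ∀ i → - 𝟙 i ≡ const -1ℤ i
    -𝟙 zero    = refl
    -𝟙 (suc i) = refl

  countDescents : t ℕ.≤ k → ∀ n s →
    + countWords k n (desX (inInitial t)) s ≡ ∑[ m < suc n ] ((XB (k ∸ t) t ^ m) n * (X-1 ^ (n ∸ m)) s)
  countDescents t≤k n s = begin
    + countWords k n des s                                   ≡⟨ count≡∑ˡδ (allWords k n) des s ⟩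
    ∑ˡ[ w ∈ allWords k n ] δ (des w) s                       ≡⟨ ∑ˡδ≡∑-binomialMoments (allWords k n) des s des≤n ⟩
    ∑[ r < suc n ] (∑ˡ[ w ∈ allWords k n ] (+ (des w C r)) * (X-1 ^ r) s)
      ≡⟨ ∑-cong (suc n) (λ r r<1+n → cong (_* (X-1 ^ r) s) (moment r (ℕP.≤-pred r<1+n))) ⟩
    ∑[ r < suc n ] ((XB (k ∸ t) t ^ (n ∸ r)) n * (X-1 ^ r) s)
      ≡⟨ ∑-reverse (suc n) _ ⟩
    ∑[ m < suc n ] ((XB (k ∸ t) t ^ (n ∸ (n ∸ m))) n * (X-1 ^ (n ∸ m)) s)
      ≡⟨ ∑-cong (suc n) (λ m m<1+n → cong (λ e → (XB (k ∸ t) t ^ e) n * (X-1 ^ (n ∸ m)) s) (ℕP.m∸[m∸n]≡n (ℕP.≤-pred m<1+n))) ⟩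
    ∑[ m < suc n ] ((XB (k ∸ t) t ^ m) n * (X-1 ^ (n ∸ m)) s)
      ∎
    where
    open ≡-Reasoning
    des : Word k n → ℕ
    des = desX (inInitial t)
    des≤n : ∀ w → des w ℕ.≤ n
    des≤n w = subst (ℕ._≤ n) (sym (desX≡pairCount (inInitial t) w)) (pairCount-≤ descent w)
    moment : ∀ r → r ℕ.≤ n → ∑ˡ[ w ∈ allWords k n ] (+ (des w C r)) ≡ (XB (k ∸ t) t ^ (n ∸ r)) n
    moment r r≤n = begin
      ∑ˡ[ w ∈ allWords k n ] (+ (des w C r))               ≡⟨ ∑ˡ-cong (allWords k n) (λ w → cong (λ d → + (d C r)) (desX≡pairCount (inInitial t) w)) ⟩
      ∑ˡ[ w ∈ allWords k n ] (+ (pairCount descent w C r)) ≡⟨ wordMoment-closed n r r≤n ⟩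
      (B ^ (n ∸ r)) r                                      ≡⟨ cong (B ^ (n ∸ r)) (ℕP.m∸[m∸n]≡n r≤n) ⟨
      (B ^ (n ∸ r)) (n ∸ (n ∸ r))                          ≡⟨ X⊛-^ B (n ∸ r) (ℕP.m∸n≤m n r) ⟨
      ((X ⊛ B) ^ (n ∸ r)) n                                ≡⟨ ^-congˡ (n ∸ r) (X⊛B≗XB t≤k) n ⟩
      (XB (k ∸ t) t ^ (n ∸ r)) n                           ∎

module Complement (k t : ℕ) (t≤k : t ℕ.≤ k) where

  open Descents k t using (descent)

  rise : Fin k → Fin k → Bool
  rise a b = ⌊ val a ℕ.<? val b ⌋ ∧ inFinal k t (val a)

  val-opposite : ∀ (a : Fin k) → val (opposite a) ≡ suc (k ∸ suc (toℕ a))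
  val-opposite a = cong suc (FinP.opposite-prop a)

  <-opposite : ∀ (a b : Fin k) → ⌊ val (opposite a) ℕ.<? val (opposite b) ⌋ ≡ ⌊ val b ℕ.<? val a ⌋
  <-opposite a b = ⌊⌋-⇔ (mk⇔ to from) _ _
    where
    to : val (opposite a) ℕ.< val (opposite b) → val b ℕ.< val a
    to p = ℕP.∸-cancelʳ-< {o = k} (ℕP.≤-pred (subst₂ ℕ._<_ (val-opposite a) (val-opposite b) p))
    from : val b ℕ.< val a → val (opposite a) ℕ.< val (opposite b)
    from q = subst₂ ℕ._<_ (sym (val-opposite a)) (sym (val-opposite b)) (s≤s (ℕP.∸-monoʳ-< q (FinP.toℕ<n a)))

  inFinal-opposite : ∀ (a : Fin k) → inFinal k t (val (opposite a)) ≡ inInitial t (val a)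
  inFinal-opposite a = trans (cong₂ _∧_ lower-bound upper-bound) (∧-identityʳ _)
    where
    lower-bound : ⌊ suc k ∸ t ℕ.≤? val (opposite a) ⌋ ≡ ⌊ toℕ a ℕ.<? t ⌋
    lower-bound = ⌊⌋-⇔ (mk⇔ to from) _ _
      where
      to : suc k ∸ t ℕ.≤ val (opposite a) → toℕ a ℕ.< t
      to p = ℕP.∸-cancelʳ-≤ (FinP.toℕ<n a) (ℕP.≤-pred (subst₂ ℕ._≤_ (ℕP.+-∸-assoc 1 t≤k) (val-opposite a) p))
      from : toℕ a ℕ.< t → suc k ∸ t ℕ.≤ val (opposite a)
      from q = subst₂ ℕ._≤_ (sym (ℕP.+-∸-assoc 1 t≤k)) (sym (val-opposite a)) (s≤s (ℕP.∸-monoʳ-≤ k q))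
    upper-bound : ⌊ val (opposite a) ℕ.≤? k ⌋ ≡ true
    upper-bound = ⌊⌋-true (val (opposite a) ℕ.≤? k)
      (subst (ℕ._≤ k) (sym (val-opposite a)) (ℕP.∸-monoʳ-< (s≤s z≤n) (FinP.toℕ<n a)))

  rise-opposite : ∀ a b → rise (opposite a) (opposite b) ≡ descent a b
  rise-opposite a b = cong₂ _∧_ (<-opposite a b) (inFinal-opposite a)

  risX-complement : ∀ {n} (w : Word k n) → risX (inFinal k t) (Vec.map opposite w) ≡ desX (inInitial t) w
  risX-complement w = begin
    risX (inFinal k t) (Vec.map opposite w)   ≡⟨ risX≡pairCount (inFinal k t) (Vec.map opposite w) ⟩
    pairCount rise (Vec.map opposite w)       ≡⟨ pairCount-relabel opposite rise-opposite w ⟩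
    pairCount descent w                       ≡⟨ desX≡pairCount (inInitial t) w ⟨
    desX (inInitial t) w                      ∎
    where open ≡-Reasoning

  countRises≡countDescents : ∀ n s → countWords k n (risX (inFinal k t)) s ≡ countWords k n (desX (inInitial t)) s
  countRises≡countDescents n s = ℤP.+-injective (begin
    + countWords k n ris s                              ≡⟨ count≡∑ˡδ (allWords k n) ris s ⟩
    ∑ˡ[ w ∈ allWords k n ] δ (ris w) s                  ≡⟨ ∑ˡ-allWords-relabel opposite (∑ˡ-allFin-opposite k) n (λ w → δ (ris w) s) ⟨
    ∑ˡ[ w ∈ allWords k n ] δ (ris (Vec.map opposite w)) s ≡⟨ ∑ˡ-cong (allWords k n) (λ w → cong (λ d → δ d s) (risX-complement w)) ⟩
    ∑ˡ[ w ∈ allWords k n ] δ (des w) s                  ≡⟨ count≡∑ˡδ (allWords k n) des s ⟨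
    + countWords k n des s                              ∎)
    where
    open ≡-Reasoning
    ris des : Word k n → ℕ
    ris = risX (inFinal k t)
    des = desX (inInitial t)

-- Evaluating the formula

Σℤ≡∑ : ∀ n f → Σℤ n f ≡ ∑ (suc n) f
Σℤ≡∑ zero    f = sym (ℤP.+-identityˡ (f 0))
Σℤ≡∑ (suc n) f = cong (_+ f (suc n)) (Σℤ≡∑ n f)

signℤ-%2 : ∀ e e′ → ℤ.∣ e ∣ % 2 ≡ ℤ.∣ e′ ∣ % 2 → signℤ e ≡ signℤ e′
signℤ-%2 e e′ eq with ℤ.∣ e ∣ % 2 | ℤ.∣ e′ ∣ % 2
... | zero  | zero  = refl
... | suc _ | suc _ = refl
... | zero  | suc _ = ⊥-elim (ℕP.0≢1+n eq)
... | suc _ | zero  = ⊥-elim (ℕP.1+n≢0 eq)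

signℤ-pos : ∀ x → signℤ (+ x) ≡ -1ℤ ℤ.^ x
signℤ-pos zero          = refl
signℤ-pos (suc zero)    = refl
signℤ-pos (suc (suc x)) = begin
  signℤ (+ suc (suc x))          ≡⟨ signℤ-%2 (+ suc (suc x)) (+ x) (trans (cong (_% 2) (ℕP.+-comm 2 x)) ([m+n]%n≡m%n x 2)) ⟩
  signℤ (+ x)                    ≡⟨ signℤ-pos x ⟩
  -1ℤ ℤ.^ x                      ≡⟨ ℤP.*-identityˡ (-1ℤ ℤ.^ x) ⟨
  -1ℤ * -1ℤ * -1ℤ ℤ.^ x          ≡⟨ ℤP.*-assoc -1ℤ -1ℤ (-1ℤ ℤ.^ x) ⟩
  -1ℤ ℤ.^ suc (suc x)            ∎
  where open ≡-Reasoning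

pos-^ : ∀ c b → + (c ℕ.^ b) ≡ (+ c) ℤ.^ b
pos-^ c zero    = refl
pos-^ c (suc b) = trans (ℤP.pos-* c (c ℕ.^ b)) (cong (λ y → + c * y) (pos-^ c b))

exponent : ∀ {n m a b s} → a ℕ.≤ m → b ℕ.≤ m ∸ a → m ℕ.≤ n → s ℕ.≤ n ∸ m →
           + n - + a - + b - + s ≡ + (m ∸ a ∸ b ℕ.+ (n ∸ m ∸ s))
exponent {n} {m} {a} {b} {s} a≤m b≤m∸a m≤n s≤n∸m = begin
  + n - + a - + b - + s                          ≡⟨ cong (λ x → + x - + a - + b - + s) n≡ ⟩
  + a + (+ b + (+ s + + E)) - + a - + b - + s    ≡⟨ cancel (+ a) (+ b) (+ s) (+ E) ⟩
  + E                                            ∎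
  where
  open ≡-Reasoning
  e₁ = m ∸ a ∸ b
  e₂ = n ∸ m ∸ s
  E = e₁ ℕ.+ e₂
  cancel : ∀ A B S Y → A + (B + (S + Y)) - A - B - S ≡ Y
  cancel = solve-∀
  shuffle : ∀ a b e₁ s e₂ → a ℕ.+ (b ℕ.+ e₁) ℕ.+ (s ℕ.+ e₂) ≡ a ℕ.+ (b ℕ.+ (s ℕ.+ (e₁ ℕ.+ e₂)))
  shuffle = ℕ-Solver.solve-∀
  n≡ : n ≡ a ℕ.+ (b ℕ.+ (s ℕ.+ E))
  n≡ = begin
    n                                    ≡⟨ ℕP.m+[n∸m]≡n m≤n ⟨
    m ℕ.+ (n ∸ m)                        ≡⟨ cong₂ ℕ._+_ (ℕP.m+[n∸m]≡n a≤m) (ℕP.m+[n∸m]≡n s≤n∸m) ⟨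
    a ℕ.+ (m ∸ a) ℕ.+ (s ℕ.+ e₂)         ≡⟨ cong (λ x → a ℕ.+ x ℕ.+ (s ℕ.+ e₂)) (ℕP.m+[n∸m]≡n b≤m∸a) ⟨
    a ℕ.+ (b ℕ.+ e₁) ℕ.+ (s ℕ.+ e₂)      ≡⟨ shuffle a b e₁ s e₂ ⟩
    a ℕ.+ (b ℕ.+ (s ℕ.+ E))              ∎

monomial-coeff : ∀ c d b e t a {n} → b ℕ.≤ n →
  ((const c ⊛ X) ^ b ⊛ const d ^ e ⊛ ((𝟙 ⊕ X) ^ t) ^ a) n ≡ c ℤ.^ b * d ℤ.^ e * + ((t ℕ.* a) C (n ∸ b))
monomial-coeff c d b e t a {n} b≤n = begin
  ((const c ⊛ X) ^ b ⊛ const d ^ e ⊛ ((𝟙 ⊕ X) ^ t) ^ a) n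
    ≡⟨ ⊛-cong (⊛-cong {g = const d ^ e} cX^b (const-^ d e)) (^-assocʳ (𝟙 ⊕ X) t a) n ⟩
  (const α ⊛ X ^ b ⊛ const β ⊛ W) n       ≡⟨ ⊛-assoc (const α ⊛ X ^ b) (const β) W n ⟩
  (const α ⊛ X ^ b ⊛ (const β ⊛ W)) n     ≡⟨ ⊛-assoc (const α) (X ^ b) (const β ⊛ W) n ⟩
  (const α ⊛ (X ^ b ⊛ (const β ⊛ W))) n   ≡⟨ const-⊛ α (X ^ b ⊛ (const β ⊛ W)) n ⟩
  α * (X ^ b ⊛ (const β ⊛ W)) n           ≡⟨ cong (α *_) (X^-⊛ b (const β ⊛ W) b≤n) ⟩
  α * (const β ⊛ W) (n ∸ b)               ≡⟨ cong (α *_) (const-⊛ β W (n ∸ b)) ⟩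
  α * (β * W (n ∸ b))                     ≡⟨ cong (λ x → α * (β * x)) (1+X^-coeff (t ℕ.* a) (n ∸ b)) ⟩
  α * (β * + ((t ℕ.* a) C (n ∸ b)))       ≡⟨ ℤP.*-assoc α β (+ ((t ℕ.* a) C (n ∸ b))) ⟨
  α * β * + ((t ℕ.* a) C (n ∸ b))         ∎
  where
  open ≡-Reasoning
  α = c ℤ.^ b
  β = d ℤ.^ e
  W = (𝟙 ⊕ X) ^ (t ℕ.* a)
  cX^b : (const c ⊛ X) ^ b ≗ const α ⊛ X ^ b
  cX^b i = trans (^-distrib-* (const c) X b i) (⊛-cong {g = X ^ b} (const-^ c b) (λ _ → refl) i)

XB^-coeff : ∀ c t {m n} → m ℕ.≤ n →
  (XB c t ^ m) n ≡ ∑[ a < suc m ] ∑[ b < suc (m ∸ a) ]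
                     (+ (m C a) * + ((m ∸ a) C b) * ((+ c) ℤ.^ b * -1ℤ ℤ.^ (m ∸ a ∸ b) * + ((t ℕ.* a) C (n ∸ b))))
XB^-coeff c t {m} {n} m≤n = begin
  (XB c t ^ m) n
    ≡⟨ binomial-coeff m U V n ⟩
  ∑[ a < suc m ] (+ (m C a) * (U ^ a ⊛ V ^ (m ∸ a)) n)
    ≡⟨ ∑-cong (suc m) (λ a _ → cong (+ (m C a) *_) (expand-V a)) ⟩
  ∑[ a < suc m ] (+ (m C a) * ∑[ b < suc (m ∸ a) ] (+ ((m ∸ a) C b) * term a b))
    ≡⟨ ∑-cong (suc m) (λ a _ → trans (*-distribˡ-∑ (suc (m ∸ a)) (+ (m C a)) _)
                                      (∑-cong (suc (m ∸ a)) (λ b _ → sym (ℤP.*-assoc (+ (m C a)) _ _)))) ⟩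
  ∑[ a < suc m ] ∑[ b < suc (m ∸ a) ] (+ (m C a) * + ((m ∸ a) C b) * term a b)
    ∎
  where
  open ≡-Reasoning
  U = (𝟙 ⊕ X) ^ t
  V = const (+ c) ⊛ X ⊕ const -1ℤ
  term : ℕ → ℕ → ℤ
  term a b = (+ c) ℤ.^ b * -1ℤ ℤ.^ (m ∸ a ∸ b) * + ((t ℕ.* a) C (n ∸ b))
  expand-V : ∀ a → (U ^ a ⊛ V ^ (m ∸ a)) n ≡ ∑[ b < suc (m ∸ a) ] (+ ((m ∸ a) C b) * term a b)
  expand-V a = begin
    (U ^ a ⊛ V ^ (m ∸ a)) n
      ≡⟨ ⊛-comm (U ^ a) (V ^ (m ∸ a)) n ⟩
    (V ^ (m ∸ a) ⊛ U ^ a) n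
      ≡⟨ binomial-⊛ (m ∸ a) (const (+ c) ⊛ X) (const -1ℤ) (U ^ a) n ⟩
    ∑[ b < suc (m ∸ a) ] (+ ((m ∸ a) C b) * ((const (+ c) ⊛ X) ^ b ⊛ const -1ℤ ^ (m ∸ a ∸ b) ⊛ U ^ a) n)
      ≡⟨ ∑-cong (suc (m ∸ a)) (λ b b<1+m∸a → cong (+ ((m ∸ a) C b) *_)
           (monomial-coeff (+ c) -1ℤ b (m ∸ a ∸ b) t a (ℕP.≤-trans (ℕP.≤-pred b<1+m∸a) (ℕP.≤-trans (ℕP.m∸n≤m m a) m≤n)))) ⟩
    ∑[ b < suc (m ∸ a) ] (+ ((m ∸ a) C b) * term a b)
      ∎

-- The sign exponent n − a − b − s of the formula is negative only when binom (n ∸ m) s = 0.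
formula-term : ∀ {n m a b} s c t → a ℕ.≤ m → b ℕ.≤ m ∸ a → m ℕ.≤ n →
  signℤ (+ n - + a - + b - + s) * + ((m C a) ℕ.* ((m ∸ a) C b) ℕ.* ((t ℕ.* a) C (n ∸ b)) ℕ.* ((n ∸ m) C s) ℕ.* c ℕ.^ b)
  ≡ + (m C a) * + ((m ∸ a) C b) * ((+ c) ℤ.^ b * -1ℤ ℤ.^ (m ∸ a ∸ b) * + ((t ℕ.* a) C (n ∸ b)))
    * (+ ((n ∸ m) C s) * -1ℤ ℤ.^ (n ∸ m ∸ s))
formula-term {n} {m} {a} {b} s c t a≤m b≤m∸a m≤n with s ℕ.≤? n ∸ m
... | yes s≤n∸m = begin
  signℤ (+ n - + a - + b - + s) * + (A ℕ.* B ℕ.* T ℕ.* S ℕ.* c ℕ.^ b)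
    ≡⟨ cong₂ _*_ sign casts ⟩
  -1ℤ ℤ.^ e₁ * -1ℤ ℤ.^ e₂ * (+ A * + B * + T * + S * (+ c) ℤ.^ b)
    ≡⟨ regroup (+ A) (+ B) (+ T) (+ S) ((+ c) ℤ.^ b) (-1ℤ ℤ.^ e₁) (-1ℤ ℤ.^ e₂) ⟩
  + A * + B * ((+ c) ℤ.^ b * -1ℤ ℤ.^ e₁ * + T) * (+ S * -1ℤ ℤ.^ e₂)
    ∎
  where
  open ≡-Reasoning
  A = m C a
  B = (m ∸ a) C b
  T = (t ℕ.* a) C (n ∸ b)
  S = (n ∸ m) C s
  e₁ = m ∸ a ∸ b
  e₂ = n ∸ m ∸ s
  sign : signℤ (+ n - + a - + b - + s) ≡ -1ℤ ℤ.^ e₁ * -1ℤ ℤ.^ e₂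
  sign = begin
    signℤ (+ n - + a - + b - + s)  ≡⟨ cong signℤ (exponent a≤m b≤m∸a m≤n s≤n∸m) ⟩
    signℤ (+ (e₁ ℕ.+ e₂))          ≡⟨ signℤ-pos (e₁ ℕ.+ e₂) ⟩
    -1ℤ ℤ.^ (e₁ ℕ.+ e₂)            ≡⟨ ℤP.^-distribˡ-+-* -1ℤ e₁ e₂ ⟩
    -1ℤ ℤ.^ e₁ * -1ℤ ℤ.^ e₂        ∎
  casts : + (A ℕ.* B ℕ.* T ℕ.* S ℕ.* c ℕ.^ b) ≡ + A * + B * + T * + S * (+ c) ℤ.^ b
  casts = begin
    + (A ℕ.* B ℕ.* T ℕ.* S ℕ.* c ℕ.^ b)        ≡⟨ ℤP.pos-* (A ℕ.* B ℕ.* T ℕ.* S) (c ℕ.^ b) ⟩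
    + (A ℕ.* B ℕ.* T ℕ.* S) * + (c ℕ.^ b)      ≡⟨ cong₂ _*_ (ℤP.pos-* (A ℕ.* B ℕ.* T) S) (pos-^ c b) ⟩
    + (A ℕ.* B ℕ.* T) * + S * (+ c) ℤ.^ b      ≡⟨ cong (λ x → x * + S * (+ c) ℤ.^ b) (ℤP.pos-* (A ℕ.* B) T) ⟩
    + (A ℕ.* B) * + T * + S * (+ c) ℤ.^ b      ≡⟨ cong (λ x → x * + T * + S * (+ c) ℤ.^ b) (ℤP.pos-* A B) ⟩
    + A * + B * + T * + S * (+ c) ℤ.^ b        ∎
  regroup : ∀ A B T S P E₁ E₂ → E₁ * E₂ * (A * B * T * S * P) ≡ A * B * (P * E₁ * T) * (S * E₂)
  regroup = solve-∀
... | no s≰n∸m rewrite k>n⇒nCk≡0 (ℕP.≰⇒> s≰n∸m) | ℕP.*-zeroʳ ((m C a) ℕ.* ((m ∸ a) C b) ℕ.* ((t ℕ.* a) C (n ∸ b))) =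
  trans (ℤP.*-zeroʳ (signℤ (+ n - + a - + b - + s)))
        (sym (ℤP.*-zeroʳ (+ (m C a) * + ((m ∸ a) C b) * ((+ c) ℤ.^ b * -1ℤ ℤ.^ (m ∸ a ∸ b) * + ((t ℕ.* a) C (n ∸ b))))))

formula≡series : ∀ k t n s → formula k t n s ≡ ∑[ m < suc n ] ((XB (k ∸ t) t ^ m) n * (X-1 ^ (n ∸ m)) s)
formula≡series k t n s = trans (Σℤ≡∑ n _) (∑-cong (suc n) (λ m m<1+n → inner-sums m (ℕP.≤-pred m<1+n)))
  where
  open ≡-Reasoning
  c = k ∸ t
  summand : ℕ → ℕ → ℕ → ℤ
  summand m a b = signℤ (+ n - + a - + b - + s)
    * + (binom m a ℕ.* binom (m ∸ a) b ℕ.* binom (t ℕ.* a) (n ∸ b) ℕ.* binom (n ∸ m) s ℕ.* c ℕ.^ b)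
  E : ℕ → ℕ → ℕ → ℤ
  E m a b = + (m C a) * + ((m ∸ a) C b) * ((+ c) ℤ.^ b * -1ℤ ℤ.^ (m ∸ a ∸ b) * + ((t ℕ.* a) C (n ∸ b)))
  inner-sums : ∀ m → m ℕ.≤ n → Σℤ m (λ a → Σℤ (m ∸ a) (summand m a)) ≡ (XB c t ^ m) n * (X-1 ^ (n ∸ m)) s
  inner-sums m m≤n = begin
    Σℤ m (λ a → Σℤ (m ∸ a) (summand m a))
      ≡⟨ Σℤ≡∑ m _ ⟩
    ∑[ a < suc m ] Σℤ (m ∸ a) (summand m a)
      ≡⟨ ∑-cong (suc m) (λ a a<1+m → trans (Σℤ≡∑ (m ∸ a) _) (∑-cong (suc (m ∸ a)) (λ b b<1+m∸a →
           formula-term s c t (ℕP.≤-pred a<1+m) (ℕP.≤-pred b<1+m∸a) m≤n))) ⟩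
    ∑[ a < suc m ] ∑[ b < suc (m ∸ a) ] (E m a b * σ)
      ≡⟨ ∑-cong (suc m) (λ a _ → *-distribʳ-∑ (suc (m ∸ a)) σ (E m a)) ⟨
    ∑[ a < suc m ] (∑[ b < suc (m ∸ a) ] E m a b * σ)
      ≡⟨ *-distribʳ-∑ (suc m) σ _ ⟨
    ∑[ a < suc m ] ∑[ b < suc (m ∸ a) ] E m a b * σ
      ≡⟨ cong₂ _*_ (XB^-coeff c t m≤n) (X-1^-coeff (n ∸ m) s) ⟨
    (XB c t ^ m) n * (X-1 ^ (n ∸ m)) s
      ∎
    where
    σ = + ((n ∸ m) C s) * -1ℤ ℤ.^ (n ∸ m ∸ s)

-- The argument also covers t = 0.
theorem4p1 : (k t n s : ℕ) → .{{_ : NonZero t}} → t ≤ k →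
    (+ countWords k n (desX (inInitial t)) s ≡ formula k t n s)
    × (+ countWords k n (risX (inFinal k t)) s ≡ formula k t n s)
theorem4p1 k t n s t≤k = descents , trans (cong +_ (Complement.countRises≡countDescents k t t≤k n s)) descents
  where
  descents : + countWords k n (desX (inInitial t)) s ≡ formula k t n s
  descents = trans (Descents.countDescents k t t≤k n s) (sym (formula≡series k t n s))
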